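{- For any may-must argumentation $F \equiv (A, R, f_Q)$ and any may-must argumentation $F' \equiv (A, R, f_Q')$ over the same $A$ and $R$, if $F \sqsubseteq F'$ holds, then $\pmb{\Gamma}[F] \subseteq \pmb{\Gamma}[F']$ holds.
   Context: Labels are $\mathcal{L} = \{\textsf{in}, \textsf{out}, \textsf{undec}\}$; a labelling $\lambda$ is a partial function from arguments to $\mathcal{L}$, and $\Lambda^{B}$ denotes the labellings defined exactly on the set $B$. A may-must scale is a pair $(x_1, x_2)$ of natural numbers with $x_1 \leq x_2$ ($x_1$ the may- condition, $x_2$ the must- condition); a nuance tuple is a pair $Q = ((n_1, n_2), (m_1, m_2))$ of may-must scales, the first for acceptance, the second for rejection. A may-must argumentation (MMA) is a tuple $(A, R, f_Q)$ with $A$ a finite set of arguments, $R \subseteq A \times A$ an attack relation, and $f_Q$ assigning a nuance tuple to each $a \in A$. For $a \in A$, $\mathrm{pre}(a)$ is the set of attackers of $a$; for a labelling $\lambda$, $\#\textsf{out}$ (resp. $\#\textsf{in}$) is the number of attackers of $a$ on which $\lambda$ is defined with value $\textsf{out}$ (resp. $\textsf{in}$). With $f_Q(a) = ((n_1,n_2),(m_1,m_2))$, $a$ satisfies under $\lambda$: may-a iff $n_1 \leq \#\textsf{out}$; must-a iff $n_2 \leq \#\textsf{out}$; may$_s$-a iff $n_1 \leq \#\textsf{out} < n_2$; not-a iff $\#\textsf{out} < n_1$; and analogously may-r, must-r, may$_s$-r, not-r using $m_1, m_2$ and $\#\textsf{in}$. A labelling $\lambda$ designates $l \in \mathcal{L}$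 for $a$ in the MMA iff $\lambda$ is defined on every attacker of $a$ and: if $l = \textsf{in}$, $a$ satisfies may-a but not must-r; if $l = \textsf{out}$, $a$ satisfies may-r but not must-a; if $l = \textsf{undec}$, either $a$ satisfies must-a and must-r, or $a$ satisfies at least one of may$_s$-a and may$_s$-r, or $a$ satisfies not-a and not-r. An abstract dialectical framework (ADF) is a tuple $(A, R, C)$ where $C$ gives, for each $a \in A$, a function $C_a : \Lambda^{\mathrm{pre}(a)} \rightarrow \mathcal{L}$. An ADF $(A, R, C)$ is a concretisation of an MMA $(A, R, f_Q)$ iff for every $a \in A$ and every $\lambda \in \Lambda^{\mathrm{pre}(a)}$, $C_a(\lambda)$ is one of the labels that $\lambda$ designates for $a$ in the MMA; $\pmb{\Gamma}[F]$ is the set of all concretisations of the MMA $F$. For nuance tuples, $Q_1 \unlhd Q_2$ iff for each $i \in \{1,2\}$, the may- condition of the $i$-th scale of $Q_2$ is $\leq$ that of $Q_1$ and the must- condition of the $i$-th scale of $Q_1$ is $\leq$ that of $Q_2$ (i.e. $Q_2$ has smaller-or-equal may- conditions and larger-or-equal must- conditions). For MMAs $(A, R, f_Q)$ and $(A, R, f_Q')$, $(A,R,f_Q) \sqsubseteq (A,R,f_Q')$ iff $f_Q(a) \unlhd f_Q'(a)$ for every $a \in A$. -}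

module Defs where

open import Data.Nat using (ℕ; zero; suc; _+_; _≤_; _<_)
open import Data.Fin using (Fin)
open import Data.Bool using (Bool; true; false)
open import Data.Maybe using (Maybe; just; nothing)
open import Data.Product using (_×_; ∃; _,_)
open import Data.Sum using (_⊎_)
open import Relation.Nullary using (¬_)
open import Relation.Binary.PropositionalEquality using (_≡_)

data Label : Set where
  lin lout lundec : Label

-- A finite set of arguments is represented as Fin k.
-- Attack relation R ⊆ A × A as a Boolean matrix: R b a ≡ true iff b attacks a.
AttackRel : ℕ → Set
AttackRel k = Fin k → Fin k → Bool

Labelling : ℕ → Set
Labelling k = Fin k → Maybe Label

sumFin : ∀ k → (Fin k → ℕ) → ℕ
sumFin zero    f = 0
sumFin (suc k) f = f Fin.zero + sumFin k (λ i → f (Fin.suc i))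
  where import Data.Fin as Fin

record Scale : Set where
  constructor scale
  field
    may  : ℕ
    must : ℕ
    may≤must : may ≤ must
open Scale public

record Nuance : Set where
  constructor nuance
  field
    acc : Scale
    rej : Scale
open Nuance public

record MMA (k : ℕ) : Set where
  constructor mma
  field
    R  : AttackRel k
    fQ : Fin k → Nuance
open MMA public

module _ {k : ℕ} (R : AttackRel k) where

  ind : Labelling k → Label → Fin k → Fin k → ℕ
  ind λl l a b with R b a | λl b
  ... | true | just lin    = isLin l
    where isLin : Label → ℕ
          isLin lin = 1
          isLin _   = 0
  ... | true | just lout   = isLout l
    where isLout : Label → ℕ
          isLout lout = 1
          isLout _    = 0
  ... | true | just lundec = isLundec l
    where isLundec : Label → ℕ
          isLundec lundec = 1
          isLundec _      = 0
  ... | true  | nothing = 0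
  ... | false | _       = 0

  count : Labelling k → Label → Fin k → ℕ
  count λl l a = sumFin k (ind λl l a)

  DefinedOnPre : Labelling k → Fin k → Set
  DefinedOnPre λl a = ∀ b → R b a ≡ true → ∃ λ l → λl b ≡ just l

  ExactlyOnPre : Labelling k → Fin k → Set
  ExactlyOnPre λl a = DefinedOnPre λl a × (∀ b → R b a ≡ false → λl b ≡ nothing)

module _ {k : ℕ} (F : MMA k) (λl : Labelling k) (a : Fin k) where
  private
    #out = count (R F) λl lout a
    #in  = count (R F) λl lin a
    n1 = may  (acc (fQ F a))
    n2 = must (acc (fQ F a))
    m1 = may  (rej (fQ F a))
    m2 = must (rej (fQ F a))

  MayA MustA MaySA NotA MayR MustR MaySR NotR : Set
  MayA  = n1 ≤ #out
  MustA = n2 ≤ #out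
  MaySA = (n1 ≤ #out) × (#out < n2)
  NotA  = #out < n1
  MayR  = m1 ≤ #in
  MustR = m2 ≤ #in
  MaySR = (m1 ≤ #in) × (#in < m2)
  NotR  = #in < m1

  Designates : Label → Set
  Designates lin    = DefinedOnPre (R F) λl a × MayA × ¬ MustR
  Designates lout   = DefinedOnPre (R F) λl a × MayR × ¬ MustA
  Designates lundec = DefinedOnPre (R F) λl a ×
                      ((MustA × MustR) ⊎ (MaySA ⊎ MaySR) ⊎ (NotA × NotR))

ADFConds : ∀ {k} → AttackRel k → Set
ADFConds {k} R = (a : Fin k) → (λl : Labelling k) → ExactlyOnPre R λl a → Label

IsConcretisation : ∀ {k} (F : MMA k) → ADFConds (R F) → Set
IsConcretisation {k} F C =
  (a : Fin k) (λl : Labelling k) (p : ExactlyOnPre (R F) λl a) → Designates F λl a (C a λl p)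

_⊆Γ_ : ∀ {k} {R : AttackRel k} → (Fin k → Nuance) → (Fin k → Nuance) → Set
_⊆Γ_ {k} {R} f f' = (C : ADFConds R) → IsConcretisation (mma R f) C → IsConcretisation (mma R f') C

_⊴_ : Nuance → Nuance → Set
Q1 ⊴ Q2 = (may (acc Q2) ≤ may (acc Q1)) × (must (acc Q1) ≤ must (acc Q2)) ×
          (may (rej Q2) ≤ may (rej Q1)) × (must (rej Q1) ≤ must (rej Q2))

_⊑_ : ∀ {k} → (Fin k → Nuance) → (Fin k → Nuance) → Set
_⊑_ {k} f f' = (a : Fin k) → f a ⊴ f' a

-- Refining a nuance tuple lowers may-conditions and raises must-conditions, so it only
-- widens each strict band [may, must).  The in/out designations need one may-condition
-- (which can only become easier) and the failure of one must-condition (which can only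
-- become harder).  For undec, a count that was at or above both must-conditions, or
-- below both may-conditions, either stays so or has entered the widened band.
module Submission where

open import Defs
open import Data.Nat using (ℕ; _≤_; _<_; _≤?_)
open import Data.Nat.Properties using (≤-trans; <-≤-trans; ≰⇒>)
open import Data.Fin using (Fin)
open import Data.Product using (_×_; _,_; proj₁; proj₂)
open import Data.Sum using (_⊎_; inj₁; inj₂)
open import Relation.Nullary using (yes; no)

record _≼_ (s s′ : Scale) : Set where
  constructor widens
  field
    may-≥  : may s′ ≤ may s
    must-≤ : must s ≤ must s′

InBand : Scale → ℕ → Set
InBand s c = (may s ≤ c) × (c < must s)

module _ {s s′ : Scale} (s≼s′ : s ≼ s′) {c : ℕ} where
  open _≼_ s≼s′ renaming (may-≥ to may′≤may; must-≤ to must≤must′)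

  may-≼ : may s ≤ c → may s′ ≤ c
  may-≼ = ≤-trans may′≤may

  must-≼⁻ : must s′ ≤ c → must s ≤ c
  must-≼⁻ = ≤-trans must≤must′

  inBand-≼ : InBand s c → InBand s′ c
  inBand-≼ (lo , hi) = may-≼ lo , <-≤-trans hi must≤must′

  must-≼ : must s ≤ c → must s′ ≤ c ⊎ InBand s′ c
  must-≼ must≤c with must s′ ≤? c
  ... | yes must′≤c = inj₁ must′≤c
  ... | no  must′≰c = inj₂ (may-≼ (≤-trans (may≤must s) must≤c) , ≰⇒> must′≰c)

  below-≼ : c < may s → c < may s′ ⊎ InBand s′ c
  below-≼ c<may with may s′ ≤? c
  ... | yes may′≤c = inj₂ (may′≤c , <-≤-trans c<may (≤-trans (may≤must s) must≤must′))
  ... | no  may′≰c = inj₁ (≰⇒> may′≰c)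

-- Definitionally the disjunction in the undec clause of Designates, with #out = o, #in = i.
UndecCondition : Nuance → ℕ → ℕ → Set
UndecCondition Q o i =
  ((must (acc Q) ≤ o) × (must (rej Q) ≤ i)) ⊎
  (InBand (acc Q) o ⊎ InBand (rej Q) i) ⊎
  ((o < may (acc Q)) × (i < may (rej Q)))

module _ {Q Q′ : Nuance} (Q⊴Q′ : Q ⊴ Q′) where
  acc-≼ : acc Q ≼ acc Q′
  acc-≼ = widens (proj₁ Q⊴Q′) (proj₁ (proj₂ Q⊴Q′))

  rej-≼ : rej Q ≼ rej Q′
  rej-≼ = widens (proj₁ (proj₂ (proj₂ Q⊴Q′))) (proj₂ (proj₂ (proj₂ Q⊴Q′)))

  undecCondition-⊴ : {o i : ℕ} → UndecCondition Q o i → UndecCondition Q′ o i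
  undecCondition-⊴ (inj₁ (o≥ , i≥)) with must-≼ acc-≼ o≥ | must-≼ rej-≼ i≥
  ... | inj₁ o≥′  | inj₁ i≥′  = inj₁ (o≥′ , i≥′)
  ... | inj₂ band | _         = inj₂ (inj₁ (inj₁ band))
  ... | inj₁ _    | inj₂ band = inj₂ (inj₁ (inj₂ band))
  undecCondition-⊴ (inj₂ (inj₁ (inj₁ band))) = inj₂ (inj₁ (inj₁ (inBand-≼ acc-≼ band)))
  undecCondition-⊴ (inj₂ (inj₁ (inj₂ band))) = inj₂ (inj₁ (inj₂ (inBand-≼ rej-≼ band)))
  undecCondition-⊴ (inj₂ (inj₂ (o< , i<))) with below-≼ acc-≼ o< | below-≼ rej-≼ i<
  ... | inj₁ o<′  | inj₁ i<′  = inj₂ (inj₂ (o<′ , i<′))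
  ... | inj₂ band | _         = inj₂ (inj₁ (inj₁ band))
  ... | inj₁ _    | inj₂ band = inj₂ (inj₁ (inj₂ band))

module _ {k : ℕ} (R : AttackRel k) (f f′ : Fin k → Nuance) (λl : Labelling k) (a : Fin k)
         (fa⊴f′a : f a ⊴ f′ a) where
  private
    acc-widens : acc (f a) ≼ acc (f′ a)
    acc-widens = acc-≼ {f a} {f′ a} fa⊴f′a
    rej-widens : rej (f a) ≼ rej (f′ a)
    rej-widens = rej-≼ {f a} {f′ a} fa⊴f′a

  designates-⊴ : (l : Label) → Designates (mma R f) λl a l → Designates (mma R f′) λl a l
  designates-⊴ lin (def , mayA , ¬mustR) =
    def , may-≼ acc-widens mayA , λ mustR′ → ¬mustR (must-≼⁻ rej-widens mustR′)
  designates-⊴ lout (def , mayR , ¬mustA) =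
    def , may-≼ rej-widens mayR , λ mustA′ → ¬mustA (must-≼⁻ acc-widens mustA′)
  designates-⊴ lundec (def , undec) = def , undecCondition-⊴ {f a} {f′ a} fa⊴f′a undec

mainTheorem2 : (k : ℕ) (R : AttackRel k) (fQ fQ' : Fin k → Nuance) →
    fQ ⊑ fQ' → _⊆Γ_ {k} {R} fQ fQ'
mainTheorem2 k R fQ fQ' fQ⊑fQ' C isConc a λl exact =
  designates-⊴ R fQ fQ' λl a (fQ⊑fQ' a) (C a λl exact) (isConc a λl exact)
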